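{- The subdivision of a tree is singular with nullity $1$.
   Context: The subdivision of a graph is obtained by inserting a new vertex of degree $2$ into each edge. The nullity of a graph is the dimension of the nullspace of its $\{0,1\}$-adjacency matrix; a graph is singular if its nullity is positive. -}

module Defs where

open import Data.Nat using (ℕ; zero; suc; _+_; _≤_; _<ᵇ_)
open import Data.Fin using (Fin; zero; suc; splitAt; toℕ; _≟_)
open import Data.Empty using (⊥)
open import Data.Bool using (Bool; true; false; _∧_; _∨_)
open import Data.Sum using (_⊎_; inj₁; inj₂)
open import Data.Product using (_×_; _,_; Σ; ∃)
open import Data.List using (List; []; _∷_; length; filterᵇ; concatMap; allFin; lookup; _∷ʳ_; map)
open import Data.List.Relation.Unary.Linked using (Linked)
open import Data.List.Relation.Unary.Unique.Propositional using (Unique)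
open import Data.Rational using (ℚ; 0ℚ; 1ℚ; _*_) renaming (_+_ to _+ℚ_)
open import Relation.Nullary.Decidable using (⌊_⌋)
open import Relation.Binary.PropositionalEquality using (_≡_)

record Graph (n : ℕ) : Set where
  field
    adj    : Fin n → Fin n → Bool
    sym    : ∀ i j → adj i j ≡ adj j i
    irrefl : ∀ i → adj i i ≡ false
open Graph public

module _ {n : ℕ} (G : Graph n) where

  Adj : Fin n → Fin n → Set
  Adj i j = adj G i j ≡ true

  data Walk : Fin n → Fin n → Set where
    [] : ∀ {i} → Walk i i
    _∷_ : ∀ {i j k} → Adj i j → Walk j k → Walk i k

  Connected : Set
  Connected = ∀ i j → Walk i j

  IsCycle : List (Fin n) → Set
  IsCycle [] = ⊥
  IsCycle (x ∷ xs) = (2 ≤ length xs) × Unique (x ∷ xs) × Linked Adj ((x ∷ xs) ∷ʳ x)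

  Acyclic : Set
  Acyclic = ∀ cs → IsCycle cs → ⊥

  IsTree : Set
  IsTree = Connected × Acyclic

  -- Subdivision: vertex set Fin n ⊎ E (E = edges), realised as Fin (n + m)

  edgeList : List (Fin n × Fin n)
  edgeList = filterᵇ (λ { (i , j) → (toℕ i <ᵇ toℕ j) ∧ adj G i j })
                     (concatMap (λ i → map (λ j → (i , j)) (allFin n)) (allFin n))

  numEdges : ℕ
  numEdges = length edgeList

  edge : Fin numEdges → Fin n × Fin n
  edge = lookup edgeList

  incident : Fin n → Fin numEdges → Bool
  incident v e with edge e
  ... | (i , j) = ⌊ v ≟ i ⌋ ∨ ⌊ v ≟ j ⌋

  subdivAdj : Fin (n + numEdges) → Fin (n + numEdges) → Bool
  subdivAdj a b with splitAt n a | splitAt n b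
  ... | inj₁ v | inj₂ e = incident v e
  ... | inj₂ e | inj₁ v = incident v e
  ... | inj₁ _ | inj₁ _ = false
  ... | inj₂ _ | inj₂ _ = false

Σ[_] : (k : ℕ) → (Fin k → ℚ) → ℚ
Σ[ zero ] f = 0ℚ
Σ[ suc k ] f = f zero +ℚ Σ[ k ] (λ i → f (suc i))

entry : Bool → ℚ
entry true  = 1ℚ
entry false = 0ℚ

mulVec : {N : ℕ} → (Fin N → Fin N → Bool) → (Fin N → ℚ) → Fin N → ℚ
mulVec {N} A x v = Σ[ N ] (λ u → entry (A v u) * x u)

InNullspace : {N : ℕ} → (Fin N → Fin N → Bool) → (Fin N → ℚ) → Set
InNullspace A x = ∀ v → mulVec A x v ≡ 0ℚ

lincomb : {N k : ℕ} → (Fin k → ℚ) → (Fin k → Fin N → ℚ) → Fin N → ℚ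
lincomb {k = k} c b v = Σ[ k ] (λ i → c i * b i v)

Nullity : {N : ℕ} → (Fin N → Fin N → Bool) → ℕ → Set
Nullity {N} A k =
  Σ (Fin k → Fin N → ℚ) λ b →
      (∀ i → InNullspace A (b i))
    × (∀ c → (∀ v → lincomb c b v ≡ 0ℚ) → ∀ i → c i ≡ 0ℚ)
    × (∀ x → InNullspace A x → ∃ λ c → ∀ v → x v ≡ lincomb c b v)

Singular : {N : ℕ} → (Fin N → Fin N → Bool) → Set
Singular A = ∃ λ k → (1 ≤ k) × Nullity A k

module Submission where

-- A vector x on the vertices and edge vertices of S(T) is in the nullspace iff
-- x_u + x_v = 0 for every edge uv (rows of the edge vertices) and the edge values
-- around every vertex sum to 0 (rows of the original vertices). Rooting T, the
-- first condition forces x_v = (-1)^depth(v) · x_root, which is consistent because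
-- adjacent vertices of a tree have depths differing by exactly one. The second
-- forces all edge values to vanish, from the leaves upwards: at a vertex, the edge
-- to its parent is the only one not already known to be zero. So the nullspace is
-- spanned by the vector that is ±1 on vertices and 0 on edge vertices.

open import Defs hiding (sym)
open import Algebra.Bundles using (CommutativeMonoid)
open import Data.Bool as Bool using (Bool; true; false; _∧_; _∨_; T)
open import Data.Bool.Properties using (T-∧; T-≡; ∨-zeroʳ)
open import Data.Empty using (⊥-elim)
open import Data.Fin using (Fin; zero; suc; toℕ; _≟_; _↑ˡ_; _↑ʳ_; splitAt)
open import Data.Fin.Properties as Fin using (any?)
open import Data.List using (List; []; _∷_; _∷ʳ_; _++_; length; lookup; map; concatMap; allFin; cartesianProduct)
open import Data.List.Extrema.Nat using (argmax; f[xs]≤f[argmax])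
open import Data.List.Membership.Propositional using (_∈_)
open import Data.List.Membership.Propositional.Properties
  using (∈-lookup; ∈-filter⁻; ∈-filter⁺; ∈-allFin; ∈-cartesianProduct⁺)
open import Data.List.Relation.Unary.All as All using (All; []; _∷_)
import Data.List.Relation.Unary.All.Properties as All
open import Data.List.Relation.Unary.AllPairs using ([]; _∷_)
open import Data.List.Relation.Unary.Any using (index)
open import Data.List.Relation.Unary.Any.Properties using (lookup-index)
open import Data.List.Relation.Unary.Linked using (Linked; []; [-]; _∷_)
open import Data.List.Relation.Unary.Unique.Propositional using (Unique)
import Data.List.Relation.Unary.Unique.Propositional.Properties as Unique
open import Data.Nat as ℕ using (ℕ; zero; suc; _≤_; _<_; z≤n; s≤s)
import Data.Nat.Properties as ℕₚ
open import Data.Product using (_×_; _,_; ∃; proj₁; proj₂)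
open import Data.Rational using (ℚ; 0ℚ; 1ℚ; _*_; _+_; -_)
import Data.Rational.Properties as ℚ
open import Data.Sum using (_⊎_; inj₁; inj₂; [_,_]′)
open import Function using (_∘_; Equivalence)
open import Relation.Binary using (tri<; tri≈; tri>)
open import Relation.Binary.PropositionalEquality
open import Relation.Nullary using (¬_; yes; no; contradiction)
open import Relation.Nullary.Decidable using (⌊_⌋; T?; _⊎-dec_; _×-dec_)
open import Relation.Unary using (Decidable)

open import Algebra.Properties.Group ℚ.+-0-group using (inverseʳ-unique)
open import Algebra.Properties.CommutativeSemigroup
  (CommutativeMonoid.commutativeSemigroup ℚ.+-0-commutativeMonoid) using (interchange)

Σ-cong : ∀ k {f g : Fin k → ℚ} → (∀ i → f i ≡ g i) → Σ[ k ] f ≡ Σ[ k ] g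
Σ-cong zero    f≗g = refl
Σ-cong (suc k) f≗g = cong₂ _+_ (f≗g zero) (Σ-cong k (f≗g ∘ suc))

Σ-0 : ∀ k {f : Fin k → ℚ} → (∀ i → f i ≡ 0ℚ) → Σ[ k ] f ≡ 0ℚ
Σ-0 zero    f≗0 = refl
Σ-0 (suc k) f≗0 = trans (cong₂ _+_ (f≗0 zero) (Σ-0 k (f≗0 ∘ suc))) (ℚ.+-identityʳ 0ℚ)

Σ-+ : ∀ k (f g : Fin k → ℚ) → Σ[ k ] (λ i → f i + g i) ≡ Σ[ k ] f + Σ[ k ] g
Σ-+ zero    f g = sym (ℚ.+-identityʳ 0ℚ)
Σ-+ (suc k) f g =
  trans (cong (f zero + g zero +_) (Σ-+ k (f ∘ suc) (g ∘ suc)))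
        (interchange (f zero) (g zero) (Σ[ k ] (f ∘ suc)) (Σ[ k ] (g ∘ suc)))

Σ-↑ : ∀ a b (f : Fin (a ℕ.+ b) → ℚ) →
  Σ[ a ℕ.+ b ] f ≡ Σ[ a ] (λ i → f (i ↑ˡ b)) + Σ[ b ] (λ j → f (a ↑ʳ j))
Σ-↑ zero    b f = sym (ℚ.+-identityˡ _)
Σ-↑ (suc a) b f =
  trans (cong (f zero +_) (Σ-↑ a b (f ∘ suc)))
        (sym (ℚ.+-assoc (f zero) (Σ[ a ] (λ i → f (suc i ↑ˡ b))) (Σ[ b ] (λ j → f (suc a ↑ʳ j)))))

Σ-single : ∀ k (f : Fin k → ℚ) i → (∀ j → j ≢ i → f j ≡ 0ℚ) → Σ[ k ] f ≡ f i
Σ-single (suc k) f zero    others =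
  trans (cong (f zero +_) (Σ-0 k (λ j → others (suc j) λ ()))) (ℚ.+-identityʳ _)
Σ-single (suc k) f (suc i) others =
  trans (cong₂ _+_ (others zero λ ())
                    (Σ-single k (f ∘ suc) i (λ j j≢i → others (suc j) (j≢i ∘ Fin.suc-injective))))
        (ℚ.+-identityˡ _)

⌊≟⌋-refl : ∀ {k} (i : Fin k) → ⌊ i ≟ i ⌋ ≡ true
⌊≟⌋-refl i with i ≟ i
... | yes _   = refl
... | no i≢i = contradiction refl i≢i

⌊≟⌋-≢ : ∀ {k} {i j : Fin k} → i ≢ j → ⌊ i ≟ j ⌋ ≡ false
⌊≟⌋-≢ {i = i} {j} i≢j with i ≟ j
... | yes i≡j = contradiction i≡j i≢j
... | no _    = refl

Σ-δ : ∀ k (f : Fin k → ℚ) i → Σ[ k ] (λ j → entry ⌊ j ≟ i ⌋ * f j) ≡ f i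
Σ-δ k f i = begin
  Σ[ k ] (λ j → entry ⌊ j ≟ i ⌋ * f j) ≡⟨ Σ-single k _ i off-diagonal ⟩
  entry ⌊ i ≟ i ⌋ * f i                ≡⟨ cong (λ b → entry b * f i) (⌊≟⌋-refl i) ⟩
  1ℚ * f i                             ≡⟨ ℚ.*-identityˡ (f i) ⟩
  f i                                  ∎
  where
  open ≡-Reasoning
  off-diagonal : ∀ j → j ≢ i → entry ⌊ j ≟ i ⌋ * f j ≡ 0ℚ
  off-diagonal j j≢i = trans (cong (λ b → entry b * f j) (⌊≟⌋-≢ j≢i)) (ℚ.*-zeroˡ (f j))

entry-∨ : ∀ a b → a ∧ b ≡ false → entry (a ∨ b) ≡ entry a + entry b
entry-∨ true  false _ = sym (ℚ.+-identityʳ 1ℚ)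
entry-∨ false b     _ = sym (ℚ.+-identityˡ (entry b))

entry*≡0 : ∀ b {x} → (b ≡ true → x ≡ 0ℚ) → entry b * x ≡ 0ℚ
entry*≡0 false {x} _   = ℚ.*-zeroˡ x
entry*≡0 true  {x} x≡0 = trans (ℚ.*-identityˡ x) (x≡0 refl)

Σ-false : ∀ k (A : Fin k → Bool) (y : Fin k → ℚ) → (∀ i → A i ≡ false) →
  Σ[ k ] (λ i → entry (A i) * y i) ≡ 0ℚ
Σ-false k A y A≗false = Σ-0 k (λ i → trans (cong (λ b → entry b * y i) (A≗false i)) (ℚ.*-zeroˡ (y i)))

Σ-δ∨δ : ∀ k (f : Fin k → ℚ) {i i′} → i ≢ i′ →
  Σ[ k ] (λ j → entry (⌊ j ≟ i ⌋ ∨ ⌊ j ≟ i′ ⌋) * f j) ≡ f i + f i′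
Σ-δ∨δ k f {i} {i′} i≢i′ = begin
  Σ[ k ] (λ j → entry (⌊ j ≟ i ⌋ ∨ ⌊ j ≟ i′ ⌋) * f j)
    ≡⟨ Σ-cong k split ⟩
  Σ[ k ] (λ j → entry ⌊ j ≟ i ⌋ * f j + entry ⌊ j ≟ i′ ⌋ * f j)
    ≡⟨ Σ-+ k _ _ ⟩
  Σ[ k ] (λ j → entry ⌊ j ≟ i ⌋ * f j) + Σ[ k ] (λ j → entry ⌊ j ≟ i′ ⌋ * f j)
    ≡⟨ cong₂ _+_ (Σ-δ k f i) (Σ-δ k f i′) ⟩
  f i + f i′ ∎
  where
  open ≡-Reasoning
  disjoint : ∀ j → ⌊ j ≟ i ⌋ ∧ ⌊ j ≟ i′ ⌋ ≡ false
  disjoint j with j ≟ i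
  ... | yes refl = ⌊≟⌋-≢ i≢i′
  ... | no _     = refl
  split : ∀ j → entry (⌊ j ≟ i ⌋ ∨ ⌊ j ≟ i′ ⌋) * f j ≡ entry ⌊ j ≟ i ⌋ * f j + entry ⌊ j ≟ i′ ⌋ * f j
  split j = trans (cong (_* f j) (entry-∨ ⌊ j ≟ i ⌋ ⌊ j ≟ i′ ⌋ (disjoint j)))
                  (ℚ.*-distribʳ-+ (f j) (entry ⌊ j ≟ i ⌋) (entry ⌊ j ≟ i′ ⌋))

leastWitness : ∀ {p} {P : ℕ → Set p} → Decidable P → ∀ {k} → P k →
  ∃ λ m → P m × (∀ {j} → j < m → ¬ P j)
leastWitness P? {zero} p0 = 0 , p0 , λ ()
leastWitness P? {suc k} pk with P? 0
... | yes p0 = 0 , p0 , λ ()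
... | no ¬p0 with leastWitness (P? ∘ suc) pk
...   | m , pm , below = suc m , pm , λ { {zero} _ → ¬p0 ; {suc j} (s≤s j<m) → below j<m }

lookup-injective : ∀ {A : Set} {xs : List A} → Unique xs → ∀ {i j} → lookup xs i ≡ lookup xs j → i ≡ j
lookup-injective {xs = _ ∷ _} _           {zero}  {zero}  _  = refl
lookup-injective {xs = _ ∷ _} (x∉ ∷ _)    {zero}  {suc j} eq = ⊥-elim (All.lookup x∉ (∈-lookup j) eq)
lookup-injective {xs = _ ∷ _} (x∉ ∷ _)    {suc i} {zero}  eq = ⊥-elim (All.lookup x∉ (∈-lookup i) (sym eq))
lookup-injective {xs = _ ∷ _} (_ ∷ uniq)  {suc i} {suc j} eq = cong suc (lookup-injective uniq eq)

concatMap-pairs : ∀ {A B : Set} (xs : List A) (ys : List B) →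
  concatMap (λ x → map (λ y → (x , y)) ys) xs ≡ cartesianProduct xs ys
concatMap-pairs []       ys = refl
concatMap-pairs (x ∷ xs) ys = cong (map (x ,_) ys ++_) (concatMap-pairs xs ys)

Linked-∷ʳ : ∀ {A : Set} {R : A → A → Set} xs {y z} → Linked R (xs ∷ʳ y) → R y z → Linked R (xs ∷ʳ y ∷ʳ z)
Linked-∷ʳ []            [-]         Ryz = Ryz ∷ [-]
Linked-∷ʳ (_ ∷ [])      (Rxy ∷ [-]) Ryz = Rxy ∷ Ryz ∷ [-]
Linked-∷ʳ (_ ∷ x ∷ xs)  (Rxx ∷ Rxs) Ryz = Rxx ∷ Linked-∷ʳ (x ∷ xs) Rxs Ryz

2≤length-∷ʳ : ∀ {A : Set} {xs : List A} {y} → 1 ≤ length xs → 2 ≤ length (xs ∷ʳ y)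
2≤length-∷ʳ {xs = _ ∷ []}    _ = s≤s (s≤s z≤n)
2≤length-∷ʳ {xs = _ ∷ _ ∷ _} _ = s≤s (s≤s z≤n)

Unique-∷ʳ : ∀ {A : Set} {xs : List A} {y} → Unique xs → All (_≢ y) xs → Unique (xs ∷ʳ y)
Unique-∷ʳ {xs = []}    []           []          = [] ∷ []
Unique-∷ʳ {xs = _ ∷ _} (x∉ ∷ uniq) (x≢y ∷ xs≢y) = All.∷ʳ⁺ x∉ x≢y ∷ Unique-∷ʳ uniq xs≢y

Adj-sym : ∀ {n} (G : Graph n) {u v} → Adj G u v → Adj G v u
Adj-sym G {u} {v} uv = trans (Graph.sym G v u) uv

Adj⇒≢ : ∀ {n} (G : Graph n) {u v} → Adj G u v → u ≢ v
Adj⇒≢ G {u} uv refl = contradiction (trans (sym uv) (Graph.irrefl G u)) λ ()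

⌊≟⌋-∨-true : ∀ {k} {v i j : Fin k} → ⌊ v ≟ i ⌋ ∨ ⌊ v ≟ j ⌋ ≡ true → v ≡ i ⊎ v ≡ j
⌊≟⌋-∨-true {v = v} {i} {j} eq with v ≟ i | v ≟ j
... | yes v≡i | _       = inj₁ v≡i
... | no _    | yes v≡j = inj₂ v≡j
... | no _    | no _    = contradiction eq λ ()

module Subdivision {n : ℕ} (G : Graph n) where

  private
    M : ℕ
    M = numEdges G

    allPairs : List (Fin n × Fin n)
    allPairs = concatMap (λ i → map (λ j → (i , j)) (allFin n)) (allFin n)

    ∈-allPairs : ∀ u v → (u , v) ∈ allPairs
    ∈-allPairs u v = subst ((u , v) ∈_) (sym (concatMap-pairs (allFin n) (allFin n)))
                           (∈-cartesianProduct⁺ (∈-allFin u) (∈-allFin v))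

  lo hi : Fin M → Fin n
  lo e = proj₁ (edge G e)
  hi e = proj₂ (edge G e)

  edge-injective : ∀ {e e′} → edge G e ≡ edge G e′ → e ≡ e′
  edge-injective = lookup-injective (Unique.filter⁺ _ allPairs-unique)
    where
    allPairs-unique : Unique allPairs
    allPairs-unique = subst Unique (sym (concatMap-pairs (allFin n) (allFin n)))
                            (Unique.cartesianProduct⁺ (Unique.allFin⁺ n) (Unique.allFin⁺ n))

  private
    edge-valid : ∀ e → T (toℕ (lo e) ℕ.<ᵇ toℕ (hi e)) × T (adj G (lo e) (hi e))
    edge-valid e = Equivalence.to T-∧ (proj₂ (∈-filter⁻ (T? ∘ _) {xs = allPairs} (∈-lookup e)))

  lo<hi : ∀ e → toℕ (lo e) < toℕ (hi e)
  lo<hi e = ℕₚ.<ᵇ⇒< _ _ (proj₁ (edge-valid e))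

  lo-hi-adjacent : ∀ e → Adj G (lo e) (hi e)
  lo-hi-adjacent e = Equivalence.to T-≡ (proj₂ (edge-valid e))

  edge⇒ordered : ∀ {e u v} → edge G e ≡ (u , v) → toℕ u < toℕ v
  edge⇒ordered {e} eq = subst (λ uv → toℕ (proj₁ uv) < toℕ (proj₂ uv)) eq (lo<hi e)

  ordered⇒edge : ∀ {u v} → toℕ u < toℕ v → Adj G u v → ∃ λ e → edge G e ≡ (u , v)
  ordered⇒edge {u} {v} u<v uv = index uv∈edges , sym (lookup-index uv∈edges)
    where
    uv∈edges : (u , v) ∈ edgeList G
    uv∈edges = ∈-filter⁺ (T? ∘ _) (∈-allPairs u v)
                 (Equivalence.from T-∧ (ℕₚ.<⇒<ᵇ u<v , Equivalence.from T-≡ uv))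

  adj⇒edge : ∀ {u v} → Adj G u v → ∃ λ e → edge G e ≡ (u , v) ⊎ edge G e ≡ (v , u)
  adj⇒edge {u} {v} uv with ℕₚ.<-cmp (toℕ u) (toℕ v)
  ... | tri< u<v _ _ = let e , eq = ordered⇒edge u<v uv in e , inj₁ eq
  ... | tri≈ _ u≡v _ = contradiction (Fin.toℕ-injective u≡v) (Adj⇒≢ G uv)
  ... | tri> _ _ v<u = let e , eq = ordered⇒edge v<u (Adj-sym G uv) in e , inj₂ eq

  incident⇒end : ∀ {v e} → incident G v e ≡ true → v ≡ lo e ⊎ v ≡ hi e
  incident⇒end = ⌊≟⌋-∨-true

  lo-incident : ∀ e → incident G (lo e) e ≡ true
  lo-incident e = cong (_∨ ⌊ lo e ≟ hi e ⌋) (⌊≟⌋-refl (lo e))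

  hi-incident : ∀ e → incident G (hi e) e ≡ true
  hi-incident e = trans (cong (⌊ hi e ≟ lo e ⌋ ∨_) (⌊≟⌋-refl (hi e))) (∨-zeroʳ _)

  -- incident G v e unfolds to a lookup in the filtered list of all vertex pairs, so
  -- the vertex and edge arguments of these lemmas are passed explicitly: solving
  -- them by unification against that term is prohibitively expensive.
  other-end : ∀ {w e} → incident G w e ≡ true → ∃ λ u → Adj G w u × incident G u e ≡ true
  other-end {w} {e} we with incident⇒end {w} {e} we
  ... | inj₁ refl = hi e , lo-hi-adjacent e , hi-incident e
  ... | inj₂ refl = lo e , Adj-sym G (lo-hi-adjacent e) , lo-incident e

  incident-both : ∀ {u v e} → u ≢ v → incident G u e ≡ true → incident G v e ≡ true →
                  edge G e ≡ (u , v) ⊎ edge G e ≡ (v , u)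
  incident-both {u} {v} {e} u≢v ue ve with incident⇒end {u} {e} ue | incident⇒end {v} {e} ve
  ... | inj₁ refl | inj₁ refl = contradiction refl u≢v
  ... | inj₁ refl | inj₂ refl = inj₁ refl
  ... | inj₂ refl | inj₁ refl = inj₂ refl
  ... | inj₂ refl | inj₂ refl = contradiction refl u≢v

  edge-determined : ∀ {u v e e′} → u ≢ v →
    incident G u e ≡ true → incident G v e ≡ true →
    incident G u e′ ≡ true → incident G v e′ ≡ true → e ≡ e′
  edge-determined {u} {v} {e} {e′} u≢v ue ve ue′ ve′
    with incident-both {e = e} u≢v ue ve | incident-both {e = e′} u≢v ue′ ve′
  ... | inj₁ p | inj₁ q = edge-injective (trans p (sym q))
  ... | inj₂ p | inj₂ q = edge-injective (trans p (sym q))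
  ... | inj₁ p | inj₂ q = contradiction (edge⇒ordered p) (ℕₚ.<⇒≯ (edge⇒ordered q))
  ... | inj₂ p | inj₁ q = contradiction (edge⇒ordered q) (ℕₚ.<⇒≯ (edge⇒ordered p))

  Σ-incident : ∀ e (f : Fin n → ℚ) → Σ[ n ] (λ v → entry (incident G v e) * f v) ≡ f (lo e) + f (hi e)
  Σ-incident e f = Σ-δ∨δ n f (Adj⇒≢ G (lo-hi-adjacent e))

  vertex : Fin n → Fin (n ℕ.+ M)
  vertex v = v ↑ˡ M

  edgeVertex : Fin M → Fin (n ℕ.+ M)
  edgeVertex e = n ↑ʳ e

  vertex-or-edgeVertex : ∀ a → (∃ λ v → vertex v ≡ a) ⊎ (∃ λ e → edgeVertex e ≡ a)
  vertex-or-edgeVertex a with splitAt n a in eq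
  ... | inj₁ v = inj₁ (v , Fin.splitAt⁻¹-↑ˡ eq)
  ... | inj₂ e = inj₂ (e , Fin.splitAt⁻¹-↑ʳ eq)

  private
    S : Fin (n ℕ.+ M) → Fin (n ℕ.+ M) → Bool
    S = subdivAdj G

    S-vv : ∀ u v → S (vertex u) (vertex v) ≡ false
    S-vv u v rewrite Fin.splitAt-↑ˡ n u M | Fin.splitAt-↑ˡ n v M = refl

    S-ve : ∀ v e → S (vertex v) (edgeVertex e) ≡ incident G v e
    S-ve v e rewrite Fin.splitAt-↑ˡ n v M | Fin.splitAt-↑ʳ n M e = refl

    S-ev : ∀ e v → S (edgeVertex e) (vertex v) ≡ incident G v e
    S-ev e v rewrite Fin.splitAt-↑ˡ n v M | Fin.splitAt-↑ʳ n M e = refl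

    S-ee : ∀ e e′ → S (edgeVertex e) (edgeVertex e′) ≡ false
    S-ee e e′ rewrite Fin.splitAt-↑ʳ n M e | Fin.splitAt-↑ʳ n M e′ = refl

    mulVec-split : ∀ x a → mulVec S x a ≡
      Σ[ n ] (λ v → entry (S a (vertex v)) * x (vertex v)) +
      Σ[ M ] (λ e → entry (S a (edgeVertex e)) * x (edgeVertex e))
    mulVec-split x a = Σ-↑ n M (λ b → entry (S a b) * x b)

  mulVec-vertex : ∀ x v →
    mulVec (subdivAdj G) x (vertex v) ≡ Σ[ M ] (λ e → entry (incident G v e) * x (edgeVertex e))
  mulVec-vertex x v = begin
    mulVec S x (vertex v)
      ≡⟨ mulVec-split x (vertex v) ⟩
    Σ[ n ] (λ u → entry (S (vertex v) (vertex u)) * x (vertex u)) +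
    Σ[ M ] (λ e → entry (S (vertex v) (edgeVertex e)) * x (edgeVertex e))
      ≡⟨ cong₂ _+_ (Σ-false n _ _ (S-vv v))
                   (Σ-cong M (λ e → cong (λ b → entry b * x (edgeVertex e)) (S-ve v e))) ⟩
    0ℚ + Σ[ M ] (λ e → entry (incident G v e) * x (edgeVertex e))
      ≡⟨ ℚ.+-identityˡ _ ⟩
    Σ[ M ] (λ e → entry (incident G v e) * x (edgeVertex e)) ∎
    where open ≡-Reasoning

  mulVec-edgeVertex : ∀ x e →
    mulVec (subdivAdj G) x (edgeVertex e) ≡ x (vertex (lo e)) + x (vertex (hi e))
  mulVec-edgeVertex x e = begin
    mulVec S x (edgeVertex e)
      ≡⟨ mulVec-split x (edgeVertex e) ⟩
    Σ[ n ] (λ v → entry (S (edgeVertex e) (vertex v)) * x (vertex v)) +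
    Σ[ M ] (λ e′ → entry (S (edgeVertex e) (edgeVertex e′)) * x (edgeVertex e′))
      ≡⟨ cong₂ _+_ (Σ-cong n (λ v → cong (λ b → entry b * x (vertex v)) (S-ev e v)))
                   (Σ-false M _ _ (S-ee e)) ⟩
    Σ[ n ] (λ v → entry (incident G v e) * x (vertex v)) + 0ℚ
      ≡⟨ ℚ.+-identityʳ _ ⟩
    Σ[ n ] (λ v → entry (incident G v e) * x (vertex v))
      ≡⟨ Σ-incident e (x ∘ vertex) ⟩
    x (vertex (lo e)) + x (vertex (hi e)) ∎
    where open ≡-Reasoning

module Depth {n : ℕ} (G : Graph (suc n)) (connected : Connected G) where

  root : Fin (suc n)
  root = zero

  Within : ℕ → Fin (suc n) → Set
  Within zero    v = v ≡ root
  Within (suc k) v = Within k v ⊎ ∃ λ u → Within k u × Adj G u v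

  within? : ∀ k → Decidable (Within k)
  within? zero    v = v ≟ root
  within? (suc k) v = within? k v ⊎-dec any? (λ u → within? k u ×-dec (adj G u v Bool.≟ true))

  walk⇒within : ∀ {u v} → Walk G u v → ∀ {k} → Within k u → ∃ λ m → Within m v
  walk⇒within []       wu = _ , wu
  walk⇒within (uw ∷ w) wu = walk⇒within w (inj₂ (_ , wu , uw))

  private
    shallowest : ∀ v → ∃ λ m → Within m v × (∀ {j} → j < m → ¬ Within j v)
    shallowest v = leastWitness (λ k → within? k v) (proj₂ (walk⇒within (connected root v) {0} refl))

  depth : Fin (suc n) → ℕ
  depth v = proj₁ (shallowest v)

  within-depth : ∀ v → Within (depth v) v
  within-depth v = proj₁ (proj₂ (shallowest v))

  depth-minimal : ∀ {v k} → Within k v → depth v ≤ k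
  depth-minimal {v} wk = ℕₚ.≮⇒≥ λ k<d → proj₂ (proj₂ (shallowest v)) k<d wk

  depth-root : depth root ≡ 0
  depth-root = ℕₚ.n≤0⇒n≡0 (depth-minimal {root} {0} refl)

  depth≡0⇒root : ∀ {v} → depth v ≡ 0 → v ≡ root
  depth≡0⇒root {v} d≡0 = subst (λ k → Within k v) d≡0 (within-depth v)

  depth-adj : ∀ {u v} → Adj G u v → depth v ≤ suc (depth u)
  depth-adj {u} uv = depth-minimal (inj₂ (u , within-depth u , uv))

  parent : ∀ {v k} → depth v ≡ suc k → ∃ λ u → Adj G u v × depth u ≡ k
  parent {v} {k} d≡1+k with subst (λ m → Within m v) d≡1+k (within-depth v)
  ... | inj₁ wk = contradiction (subst (_≤ k) d≡1+k (depth-minimal wk)) ℕₚ.1+n≰n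
  ... | inj₂ (u , wu , uv) =
    u , uv , ℕₚ.≤-antisym (depth-minimal wu)
                          (ℕₚ.≤-pred (subst (_≤ suc (depth u)) d≡1+k (depth-adj uv)))

  deepest : Fin (suc n)
  deepest = argmax depth root (allFin (suc n))

  depth≤deepest : ∀ v → depth v ≤ depth deepest
  depth≤deepest v = All.lookup (f[xs]≤f[argmax] {f = depth} root (allFin (suc n))) (∈-allFin v)

module TreeDepth {n : ℕ} (G : Graph (suc n)) (tree : IsTree G) where

  open Depth G (proj₁ tree) public

  private
    acyclic : Acyclic G
    acyclic = proj₂ tree

    shallower⇒≢ : ∀ {x v} → depth x < depth v → v ≢ x
    shallower⇒≢ x<v refl = ℕₚ.<-irrefl refl x<v

    unique-between : ∀ {k a b xs} → Unique xs → All (λ x → depth x < k) xs →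
      depth a ≡ k → depth b ≡ k → a ≢ b → Unique (a ∷ xs ∷ʳ b)
    unique-between uniq shallow refl db a≢b =
      All.∷ʳ⁺ (All.map shallower⇒≢ shallow) a≢b ∷
      Unique-∷ʳ uniq (All.map (λ x<k x≡b → shallower⇒≢ (subst (_ <_) (sym db) x<k) (sym x≡b)) shallow)

    below : ∀ {x k} → depth x ≡ k → depth x < suc k
    below refl = ℕₚ.n<1+n _

  -- Two distinct vertices of equal depth are joined through their ancestors by a
  -- path whose inner vertices are all shallower. Closing such a path by an edge
  -- between its ends, or through a common deeper neighbour, would create a cycle.
  record ShallowPath (k : ℕ) (a b : Fin (suc n)) : Set where
    field
      inner    : List (Fin (suc n))
      nonempty : 1 ≤ length inner
      shallow  : All (λ x → depth x < k) inner
      distinct : Unique (a ∷ inner ∷ʳ b)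
      linked   : Linked (Adj G) (a ∷ inner ∷ʳ b)

  sameDepth-path : ∀ k {a b} → depth a ≡ k → depth b ≡ k → a ≢ b → ShallowPath k a b
  sameDepth-path zero    da db a≢b = contradiction (trans (depth≡0⇒root da) (sym (depth≡0⇒root db))) a≢b
  sameDepth-path (suc k) {a} {b} da db a≢b with parent da | parent db
  ... | pa , pa-a , dpa | pb , pb-b , dpb with pa ≟ pb
  ...   | yes refl = record
    { inner    = pa ∷ []
    ; nonempty = s≤s z≤n
    ; shallow  = below dpa ∷ []
    ; distinct = unique-between ([] ∷ []) (below dpa ∷ []) da db a≢b
    ; linked   = Adj-sym G pa-a ∷ pb-b ∷ [-]
    }
  ...   | no pa≢pb = record
    { inner    = pa ∷ inner ∷ʳ pb
    ; nonempty = s≤s z≤n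
    ; shallow  = shallow′
    ; distinct = unique-between distinct shallow′ da db a≢b
    ; linked   = Adj-sym G pa-a ∷ Linked-∷ʳ (pa ∷ inner) linked pb-b
    }
    where
    open ShallowPath (sameDepth-path k dpa dpb pa≢pb)
    shallow′ : All (λ x → depth x < suc k) (pa ∷ inner ∷ʳ pb)
    shallow′ = below dpa ∷ All.∷ʳ⁺ (All.map ℕₚ.m<n⇒m<1+n shallow) (below dpb)

  sameDepth-nonadjacent : ∀ {a b} → depth a ≡ depth b → ¬ Adj G a b
  sameDepth-nonadjacent {a} {b} da≡db ab =
    acyclic (a ∷ inner ∷ʳ b)
      (2≤length-∷ʳ {xs = inner} nonempty , distinct , Linked-∷ʳ (a ∷ inner) linked (Adj-sym G ab))
    where open ShallowPath (sameDepth-path (depth a) refl (sym da≡db) (Adj⇒≢ G ab))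

  adj-depth : ∀ {u v} → Adj G u v → depth v ≡ suc (depth u) ⊎ depth u ≡ suc (depth v)
  adj-depth {u} {v} uv with ℕₚ.<-cmp (depth u) (depth v)
  ... | tri< du<dv _ _ = inj₁ (ℕₚ.≤-antisym (depth-adj uv) du<dv)
  ... | tri≈ _ du≡dv _ = contradiction uv (sameDepth-nonadjacent du≡dv)
  ... | tri> _ _ dv<du = inj₂ (ℕₚ.≤-antisym (depth-adj (Adj-sym G uv)) dv<du)

  parent-unique : ∀ {u u′ v} → Adj G u v → Adj G u′ v →
    depth v ≡ suc (depth u) → depth v ≡ suc (depth u′) → u ≡ u′
  parent-unique {u} {u′} {v} uv u′v dv dv′ with u ≟ u′
  ... | yes u≡u′ = u≡u′
  ... | no u≢u′ = ⊥-elim (acyclic (v ∷ u ∷ inner ∷ʳ u′)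
          ( 2≤length-∷ʳ {xs = u ∷ inner} (s≤s z≤n)
          , All.map (λ x<du → shallower⇒≢ (subst (_ <_) (sym dv) x<du)) shallow′ ∷ distinct
          , Adj-sym G uv ∷ Linked-∷ʳ (u ∷ inner) linked u′v))
    where
    du≡du′ : depth u ≡ depth u′
    du≡du′ = ℕₚ.suc-injective (trans (sym dv) dv′)
    open ShallowPath (sameDepth-path (depth u) refl (sym du≡du′) u≢u′)
    shallow′ : All (λ x → depth x < suc (depth u)) (u ∷ inner ∷ʳ u′)
    shallow′ = below refl ∷ All.∷ʳ⁺ (All.map ℕₚ.m<n⇒m<1+n shallow) (below (sym du≡du′))

sign : ℕ → ℚ
sign zero    = 1ℚ
sign (suc k) = - sign k

module Kernel {n : ℕ} (G : Graph (suc n)) (tree : IsTree G) where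

  open TreeDepth G tree
  open Subdivision G

  private
    N M : ℕ
    N = suc n
    M = numEdges G

  sign-adj : ∀ {u v} → Adj G u v → sign (depth u) + sign (depth v) ≡ 0ℚ
  sign-adj {u} {v} uv with adj-depth uv
  ... | inj₁ dv rewrite dv = ℚ.+-inverseʳ (sign (depth u))
  ... | inj₂ du rewrite du = ℚ.+-inverseˡ (sign (depth v))

  kernelVector : Fin (N ℕ.+ M) → ℚ
  kernelVector a = [ sign ∘ depth , (λ _ → 0ℚ) ]′ (splitAt N a)

  kernelVector-vertex : ∀ v → kernelVector (vertex v) ≡ sign (depth v)
  kernelVector-vertex v rewrite Fin.splitAt-↑ˡ N v M = refl

  kernelVector-edgeVertex : ∀ e → kernelVector (edgeVertex e) ≡ 0ℚ
  kernelVector-edgeVertex e rewrite Fin.splitAt-↑ʳ N M e = refl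

  kernelVector-null : InNullspace (subdivAdj G) kernelVector
  kernelVector-null a with vertex-or-edgeVertex a
  ... | inj₁ (v , refl) = trans (mulVec-vertex kernelVector v)
          (Σ-0 M (λ e → entry*≡0 (incident G v e) (λ _ → kernelVector-edgeVertex e)))
  ... | inj₂ (e , refl) = trans (mulVec-edgeVertex kernelVector e)
          (trans (cong₂ _+_ (kernelVector-vertex (lo e)) (kernelVector-vertex (hi e))) (sign-adj (lo-hi-adjacent e)))

  antisymmetric⇒alternating : (y : Fin N → ℚ) → (∀ {u v} → Adj G u v → y u + y v ≡ 0ℚ) →
    ∀ v → y v ≡ y root * sign (depth v)
  antisymmetric⇒alternating y y-edge v = go (depth v) v refl
    where
    go : ∀ k v → depth v ≡ k → y v ≡ y root * sign k
    go zero    v dv rewrite depth≡0⇒root dv = sym (ℚ.*-identityʳ (y root))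
    go (suc k) v dv = let u , uv , du = parent dv in begin
      y v                  ≡⟨ inverseʳ-unique (y u) (y v) (y-edge uv) ⟩
      - y u                ≡⟨ cong -_ (go k u du) ⟩
      - (y root * sign k)  ≡⟨ ℚ.neg-distribʳ-* (y root) (sign k) ⟩
      y root * - sign k    ∎
      where open ≡-Reasoning

  Balanced : (Fin M → ℚ) → Set
  Balanced z = ∀ w → Σ[ M ] (λ e → entry (incident G w e) * z e) ≡ 0ℚ

  private
    enoughFuel : ∀ w → depth deepest < depth w ℕ.+ suc (depth deepest)
    enoughFuel w = ℕₚ.m≤n⇒m≤o+n (depth w) (ℕₚ.n<1+n _)

  module _ (z : Fin M → ℚ) (balanced : Balanced z) where

    -- Induction on the fuel t, which bounds the height of w above the deepest vertex.
    -- The row of w kills every edge at w except the one to its parent: edges to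
    -- children vanish by induction and the parent is unique.
    parentEdge-zero : ∀ t {u w e} → depth deepest < depth w ℕ.+ t → Adj G u w → depth w ≡ suc (depth u) →
      incident G u e ≡ true → incident G w e ≡ true → z e ≡ 0ℚ
    parentEdge-zero zero {w = w} bound _ _ _ _ =
      contradiction (depth≤deepest w) (ℕₚ.<⇒≱ (subst (_ <_) (ℕₚ.+-identityʳ (depth w)) bound))
    parentEdge-zero (suc t) {u} {w} {e} bound uw dw ue we = begin
      z e                                            ≡⟨ ℚ.*-identityˡ (z e) ⟨
      entry true * z e                               ≡⟨ cong (λ b → entry b * z e) we ⟨
      entry (incident G w e) * z e                   ≡⟨ Σ-single M _ e otherTerms-zero ⟨
      Σ[ M ] (λ e′ → entry (incident G w e′) * z e′) ≡⟨ balanced w ⟩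
      0ℚ                                             ∎
      where
      open ≡-Reasoning
      otherEdge-zero : ∀ e′ → e′ ≢ e → incident G w e′ ≡ true → z e′ ≡ 0ℚ
      otherEdge-zero e′ e′≢e we′ = viaNeighbour (other-end {w} {e′} we′)
        where
        viaNeighbour : (∃ λ u′ → Adj G w u′ × incident G u′ e′ ≡ true) → z e′ ≡ 0ℚ
        viaNeighbour (u′ , wu′ , u′e′) = [ viaChild , viaParent ]′ (adj-depth wu′)
          where
          viaChild : depth u′ ≡ suc (depth w) → z e′ ≡ 0ℚ
          viaChild du′ = parentEdge-zero t {e = e′} bound′ wu′ du′ we′ u′e′
            where
            bound′ : depth deepest < depth u′ ℕ.+ t
            bound′ = subst (λ d → depth deepest < d ℕ.+ t) (sym du′)
                           (subst (depth deepest <_) (ℕₚ.+-suc (depth w) t) bound)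
          viaParent : depth w ≡ suc (depth u′) → z e′ ≡ 0ℚ
          viaParent dw′ = contradiction (edge-determined {e = e} {e′} (Adj⇒≢ G uw) ue we ue′ we′) (e′≢e ∘ sym)
            where
            ue′ : incident G u e′ ≡ true
            ue′ = subst (λ x → incident G x e′ ≡ true) (parent-unique (Adj-sym G wu′) uw dw′ dw) u′e′
      otherTerms-zero : ∀ e′ → e′ ≢ e → entry (incident G w e′) * z e′ ≡ 0ℚ
      otherTerms-zero e′ e′≢e = entry*≡0 (incident G w e′) (otherEdge-zero e′ e′≢e)

    balanced⇒zero : ∀ e → z e ≡ 0ℚ
    balanced⇒zero e with adj-depth (lo-hi-adjacent e)
    ... | inj₁ dhi = parentEdge-zero _ {e = e} (enoughFuel (hi e)) (lo-hi-adjacent e) dhi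
                                     (lo-incident e) (hi-incident e)
    ... | inj₂ dlo = parentEdge-zero _ {e = e} (enoughFuel (lo e)) (Adj-sym G (lo-hi-adjacent e)) dlo
                                     (hi-incident e) (lo-incident e)

  module _ {x : Fin (N ℕ.+ M) → ℚ} (null : InNullspace (subdivAdj G) x) where

    null-adjacent : ∀ {u v} → Adj G u v → x (vertex u) + x (vertex v) ≡ 0ℚ
    null-adjacent uv with adj⇒edge uv
    ... | e , inj₁ refl = trans (sym (mulVec-edgeVertex x e)) (null (edgeVertex e))
    ... | e , inj₂ refl = trans (ℚ.+-comm (x (vertex (hi e))) (x (vertex (lo e))))
                                (trans (sym (mulVec-edgeVertex x e)) (null (edgeVertex e)))

    null-balanced : Balanced (x ∘ edgeVertex)
    null-balanced w = trans (sym (mulVec-vertex x w)) (null (vertex w))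

    null⇒multiple : ∀ a → x a ≡ x (vertex root) * kernelVector a
    null⇒multiple a with vertex-or-edgeVertex a
    ... | inj₁ (v , refl) = begin
      x (vertex v)                          ≡⟨ antisymmetric⇒alternating (x ∘ vertex) null-adjacent v ⟩
      x (vertex root) * sign (depth v)      ≡⟨ cong (x (vertex root) *_) (kernelVector-vertex v) ⟨
      x (vertex root) * kernelVector (vertex v) ∎
      where open ≡-Reasoning
    ... | inj₂ (e , refl) = begin
      x (edgeVertex e)                      ≡⟨ balanced⇒zero (x ∘ edgeVertex) null-balanced e ⟩
      0ℚ                                    ≡⟨ ℚ.*-zeroʳ (x (vertex root)) ⟨
      x (vertex root) * 0ℚ                  ≡⟨ cong (x (vertex root) *_) (kernelVector-edgeVertex e) ⟨
      x (vertex root) * kernelVector (edgeVertex e) ∎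
      where open ≡-Reasoning

  nullity : Nullity (subdivAdj G) 1
  nullity = (λ _ → kernelVector) , (λ _ → kernelVector-null) , independent , spanning
    where
    independent : ∀ c → (∀ a → lincomb c (λ _ → kernelVector) a ≡ 0ℚ) → ∀ i → c i ≡ 0ℚ
    independent c vanish zero = begin
      c zero                                      ≡⟨ ℚ.*-identityʳ (c zero) ⟨
      c zero * 1ℚ                                 ≡⟨ cong (λ k → c zero * sign k) depth-root ⟨
      c zero * sign (depth root)                  ≡⟨ cong (c zero *_) (kernelVector-vertex root) ⟨
      c zero * kernelVector (vertex root)         ≡⟨ ℚ.+-identityʳ _ ⟨
      lincomb c (λ _ → kernelVector) (vertex root) ≡⟨ vanish (vertex root) ⟩
      0ℚ                                          ∎
      where open ≡-Reasoning
    spanning : ∀ x → InNullspace (subdivAdj G) x → ∃ λ c → ∀ a → x a ≡ lincomb c (λ _ → kernelVector) a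
    spanning x null = (λ _ → x (vertex root)) , λ a →
      trans (null⇒multiple {x} null a) (sym (ℚ.+-identityʳ (x (vertex root) * kernelVector a)))

mainTheorem15 : (n : ℕ) (G : Graph (suc n)) → IsTree G →
    Singular (subdivAdj G) × Nullity (subdivAdj G) 1
mainTheorem15 n G tree = (1 , ℕₚ.≤-refl , nullity) , nullity
  where open Kernel G tree
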